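{- Let $M$ be any ternary relation on closed BCCSP processes, and consider the axiom schemes (for every $a\in\mathit{Act}$) $(ND)$: $M(x,y,w)\Rightarrow a(x+y)\preceq ax+a(y+w)$; $(ND_+)$: $M(x,y,w)\Rightarrow ax+a(y+w)+a(x+y)\preceq ax+a(y+w)$; $(ND_\equiv)$: $M(x,y,w)\Rightarrow ax+a(y+w)+a(x+y)\simeq ax+a(y+w)$. Then (1) $\{B_1\text{ -- }B_4,(RS),(ND)\}$ is logically equivalent to $\{B_1\text{ -- }B_4,(RS),(ND_+)\}$, and (2) $\{B_1\text{ -- }B_4,(RS),(ND_+)\}$ is logically equivalent to $\{B_1\text{ -- }B_4,(RS),(ND_\equiv)\}$.
   Context: BCCSP processes over a set $\mathit{Act}$: $p ::= \mathbf{0}\mid ap\mid p+q$, terms may contain variables; transitions $ap\xrightarrow{a}p$, and $p\xrightarrow{a}p'$ implies $p+q\xrightarrow{a}p'$ and $q+p\xrightarrow{a}p'$. $I(p)=\{a\mid \exists p'.\,p\xrightarrow{a}p'\}$. Derivability $E\vdash t\preceq u$ uses reflexivity, transitivity, closure under prefixing ($t\preceq u\Rightarrow at\preceq au$) and sum, and closed substitution instances of axioms, conditional axioms being usable only under closed substitutions satisfying their condition; $t\simeq u$ abbreviates $t\preceq u$ and $u\preceq t$. Two axiom sets are logically equivalent if each axiom of one is derivable from the other, i.e. they derive the same inequations. Axioms: $(B_1)$ $x+y\simeq y+x$; $(B_2)$ $(x+y)+z\simeq x+(y+z)$; $(B_3)$ $x+x\simeq x$; $(B_4)$ $x+\mathbf{0}\simeq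 x$; $(RS)$ $I(x)=I(y)\Rightarrow x\preceq x+y$. -}

module Defs where

open import Data.Empty using (⊥)
open import Data.Nat using (ℕ)
open import Data.Product using (Σ; _×_)
open import Data.Sum using (_⊎_; inj₁; inj₂)
open import Function.Bundles using (_⇔_)

data Term (A : Set) (V : Set) : Set where
  𝟎   : Term A V
  _·_ : A → Term A V → Term A V
  _⊕_ : Term A V → Term A V → Term A V
  var : V → Term A V

infixr 7 _·_
infixl 6 _⊕_

-- Variables of open terms (x = 0, y = 1, z/w = 2, ...).
OTerm : Set → Set
OTerm A = Term A ℕ

Proc : Set → Set
Proc A = Term A ⊥

CSubst : Set → Set
CSubst A = ℕ → Proc A

_[_] : {A V : Set} → Term A V → (V → Proc A) → Proc A
𝟎 [ σ ] = 𝟎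
(a · t) [ σ ] = a · (t [ σ ])
(t ⊕ u) [ σ ] = (t [ σ ]) ⊕ (u [ σ ])
var v [ σ ] = σ v

data _—⟨_⟩→_ {A : Set} : Proc A → A → Proc A → Set where
  pref : ∀ {a p} → (a · p) —⟨ a ⟩→ p
  sumˡ : ∀ {p q a p'} → p —⟨ a ⟩→ p' → (p ⊕ q) —⟨ a ⟩→ p'
  sumʳ : ∀ {p q a p'} → p —⟨ a ⟩→ p' → (q ⊕ p) —⟨ a ⟩→ p'

_∈I_ : {A : Set} → A → Proc A → Set
_∈I_ {A} a p = Σ (Proc A) (λ p' → p —⟨ a ⟩→ p')

SameInit : {A : Set} → Proc A → Proc A → Set
SameInit {A} p q = (a : A) → (a ∈I p) ⇔ (a ∈I q)

record Axiom (A : Set) : Set₁ where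
  constructor ax
  field
    cond : CSubst A → Set
    lhs  : OTerm A
    rhs  : OTerm A

record AxSet (A : Set) : Set₁ where
  constructor axset
  field
    Idx : Set
    axiom : Idx → Axiom A

_∪_ : {A : Set} → AxSet A → AxSet A → AxSet A
axset I f ∪ axset J g = axset (I ⊎ J) λ { (inj₁ i) → f i ; (inj₂ j) → g j }

data _⊢_≼_ {A : Set} (E : AxSet A) : Proc A → Proc A → Set where
  ≼-refl  : ∀ {p} → E ⊢ p ≼ p
  ≼-trans : ∀ {p q r} → E ⊢ p ≼ q → E ⊢ q ≼ r → E ⊢ p ≼ r
  ≼-pref  : ∀ {p q} (a : A) → E ⊢ p ≼ q → E ⊢ (a · p) ≼ (a · q)
  ≼-sum   : ∀ {p p' q q'} → E ⊢ p ≼ p' → E ⊢ q ≼ q' → E ⊢ (p ⊕ q) ≼ (p' ⊕ q')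
  ≼-inst  : (i : AxSet.Idx E) (σ : CSubst A) →
            Axiom.cond (AxSet.axiom E i) σ →
            E ⊢ (Axiom.lhs (AxSet.axiom E i) [ σ ]) ≼ (Axiom.rhs (AxSet.axiom E i) [ σ ])

Derives : {A : Set} → AxSet A → AxSet A → Set
Derives {A} E F = (i : AxSet.Idx F) (σ : CSubst A) → Axiom.cond (AxSet.axiom F i) σ →
  E ⊢ (Axiom.lhs (AxSet.axiom F i) [ σ ]) ≼ (Axiom.rhs (AxSet.axiom F i) [ σ ])

LogEquiv : {A : Set} → AxSet A → AxSet A → Set
LogEquiv E F = Derives E F × Derives F E

x y z : {A : Set} → OTerm A
x = var 0
y = var 1
z = var 2

Always : {A : Set} → CSubst A → Set
Always _ = Data.Unit.⊤
  where import Data.Unit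

-- B1–B4 (each ≃ given as two inequations)
data BIdx : Set where
  b1l b1r b2l b2r b3l b3r b4l b4r : BIdx

Bax : {A : Set} → BIdx → Axiom A
Bax b1l = ax Always (x ⊕ y) (y ⊕ x)
Bax b1r = ax Always (y ⊕ x) (x ⊕ y)
Bax b2l = ax Always ((x ⊕ y) ⊕ z) (x ⊕ (y ⊕ z))
Bax b2r = ax Always (x ⊕ (y ⊕ z)) ((x ⊕ y) ⊕ z)
Bax b3l = ax Always (x ⊕ x) x
Bax b3r = ax Always x (x ⊕ x)
Bax b4l = ax Always (x ⊕ 𝟎) x
Bax b4r = ax Always x (x ⊕ 𝟎)

RSax : {A : Set} → Axiom A
RSax = ax (λ σ → SameInit (σ 0) (σ 1)) x (x ⊕ y)

BRS : (A : Set) → AxSet A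
BRS A = axset (BIdx ⊎ Data.Unit.⊤) (λ { (inj₁ b) → Bax b ; (inj₂ _) → RSax })
  where import Data.Unit

Ternary : Set → Set₁
Ternary A = Proc A → Proc A → Proc A → Set

-- Here x = var 0, y = var 1, w = var 2.
MCond : {A : Set} → Ternary A → CSubst A → Set
MCond M σ = M (σ 0) (σ 1) (σ 2)

ND : {A : Set} → Ternary A → AxSet A
ND {A} M = axset A λ a → ax (MCond M) (a · (x ⊕ y)) (a · x ⊕ a · (y ⊕ z))

NDplus : {A : Set} → Ternary A → AxSet A
NDplus {A} M = axset A λ a →
  ax (MCond M) (a · x ⊕ a · (y ⊕ z) ⊕ a · (x ⊕ y)) (a · x ⊕ a · (y ⊕ z))

NDeq : {A : Set} → Ternary A → AxSet A
NDeq {A} M = axset (A ⊎ A) λ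
  { (inj₁ a) → ax (MCond M) (a · x ⊕ a · (y ⊕ z) ⊕ a · (x ⊕ y)) (a · x ⊕ a · (y ⊕ z))
  ; (inj₂ a) → ax (MCond M) (a · x ⊕ a · (y ⊕ z)) (a · x ⊕ a · (y ⊕ z) ⊕ a · (x ⊕ y)) }

-- With u = ax + a(y+w), every process a·p has the same initials as u, namely {a}.
-- Hence (RS) gives a(x+y) ≼ a(x+y) + u and u ≼ u + a(x+y), which, together with
-- commutativity and idempotence of +, converts each form of the axiom into the others.
module Submission where

open import Defs
open import Data.Nat using (zero; suc)
open import Data.Product using (_×_; _,_)
open import Data.Sum using (inj₁; inj₂)
open import Data.Unit using (tt)
open import Function.Bundles using (mk⇔)
import Function.Properties.Equivalence as ⇔

module _ {A : Set} where

  SameInit-sym : {p q : Proc A} → SameInit p q → SameInit q p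
  SameInit-sym s a = ⇔.sym (s a)

  SameInit-prefix-sum : (a : A) (p q r : Proc A) → SameInit (a · p) (a · q ⊕ a · r)
  SameInit-prefix-sum a p q r b = mk⇔ to from
    where
    to : b ∈I (a · p) → b ∈I (a · q ⊕ a · r)
    to (_ , pref) = q , sumˡ pref
    from : b ∈I (a · q ⊕ a · r) → b ∈I (a · p)
    from (_ , sumˡ pref) = p , pref
    from (_ , sumʳ pref) = p , pref

  Derives-BRS-∪ : (F G : AxSet A) →
    ((i : AxSet.Idx G) (σ : CSubst A) → Axiom.cond (AxSet.axiom G i) σ →
      (BRS A ∪ F) ⊢ (Axiom.lhs (AxSet.axiom G i) [ σ ]) ≼ (Axiom.rhs (AxSet.axiom G i) [ σ ])) →
    Derives (BRS A ∪ F) (BRS A ∪ G)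
  Derives-BRS-∪ F G d (inj₁ i) σ c = ≼-inst (inj₁ i) σ c
  Derives-BRS-∪ F G d (inj₂ i) σ c = d i σ c

  module BRS-Instances (F : AxSet A) where

    pair : Proc A → Proc A → CSubst A
    pair p q zero    = p
    pair p q (suc _) = q

    +-comm : (p q : Proc A) → (BRS A ∪ F) ⊢ (p ⊕ q) ≼ (q ⊕ p)
    +-comm p q = ≼-inst (inj₁ (inj₁ b1l)) (pair p q) tt

    +-idem : (p : Proc A) → (BRS A ∪ F) ⊢ (p ⊕ p) ≼ p
    +-idem p = ≼-inst (inj₁ (inj₁ b3l)) (λ _ → p) tt

    RS : (p q : Proc A) → SameInit p q → (BRS A ∪ F) ⊢ p ≼ (p ⊕ q)
    RS p q = ≼-inst (inj₁ (inj₂ tt)) (pair p q)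

    axiom : (i : AxSet.Idx F) (σ : CSubst A) → Axiom.cond (AxSet.axiom F i) σ →
      (BRS A ∪ F) ⊢ (Axiom.lhs (AxSet.axiom F i) [ σ ]) ≼ (Axiom.rhs (AxSet.axiom F i) [ σ ])
    axiom i = ≼-inst (inj₂ i)

  module _ (M : Ternary A) where

    ND⇒NDplus : Derives (BRS A ∪ ND M) (BRS A ∪ NDplus M)
    ND⇒NDplus = Derives-BRS-∪ (ND M) (NDplus M) λ a σ c →
      ≼-trans (≼-sum ≼-refl (axiom a σ c)) (+-idem _)
      where open BRS-Instances (ND M)

    NDplus⇒ND : Derives (BRS A ∪ NDplus M) (BRS A ∪ ND M)
    NDplus⇒ND = Derives-BRS-∪ (NDplus M) (ND M) λ a σ c →
      ≼-trans (RS _ _ (SameInit-prefix-sum a (σ 0 ⊕ σ 1) (σ 0) (σ 1 ⊕ σ 2)))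
        (≼-trans (+-comm _ _) (axiom a σ c))
      where open BRS-Instances (NDplus M)

    NDplus⇒NDeq : Derives (BRS A ∪ NDplus M) (BRS A ∪ NDeq M)
    NDplus⇒NDeq = Derives-BRS-∪ (NDplus M) (NDeq M) λ
      { (inj₁ a) σ c → axiom a σ c
      ; (inj₂ a) σ c →
          RS _ _ (SameInit-sym (SameInit-prefix-sum a (σ 0 ⊕ σ 1) (σ 0) (σ 1 ⊕ σ 2))) }
      where open BRS-Instances (NDplus M)

    NDeq⇒NDplus : Derives (BRS A ∪ NDeq M) (BRS A ∪ NDplus M)
    NDeq⇒NDplus = Derives-BRS-∪ (NDeq M) (NDplus M) λ a → axiom (inj₁ a)
      where open BRS-Instances (NDeq M)

proposition3p5 : (Act : Set) (M : Ternary Act) →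
    LogEquiv (BRS Act ∪ ND M) (BRS Act ∪ NDplus M)
    × LogEquiv (BRS Act ∪ NDplus M) (BRS Act ∪ NDeq M)
proposition3p5 Act M =
  (ND⇒NDplus M , NDplus⇒ND M) , (NDplus⇒NDeq M , NDeq⇒NDplus M)
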